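{- Let $\mathcal{V}$ be a variety of $\mathcal{F}$-algebras, let $\mathbf{I}=([m];\mathcal{F})$ $(m>0)$ be a finite algebra in $\mathcal{V}$, and let $\mathcal{V}^*$ be the variety of all $\hat{\mathcal{F}}_{\mathbf{I}}$-algebras that are isomorphic to algebras $\mathfrak{C}(\mathbf{A},\chi)$ with $(\mathbf{A},\chi)$ an object of $(\mathcal{V}\downdownarrows\mathbf{I})$. (1) The map \[ t(x_1,\dots,x_k)\mapsto \breve{t}(\mathbf{x}_1,\dots,\mathbf{x}_k):=\begin{bmatrix} t(x_1^{(1)},\dots,x_k^{(1)})\\ \vdots\\ t(x_1^{(m)},\dots,x_k^{(m)})\end{bmatrix}, \] which assigns to every idempotent term $t(x_1,\dots,x_k)$ of $\mathcal{V}$ the idempotent term $\breve{t}(\mathbf{x}_1,\dots,\mathbf{x}_k)$ of $\mathcal{V}^*$ with coordinate terms $t(x_1^{(i)},\dots,x_k^{(i)})$ $(i\in[m])$, is a clone homomorphism of the clone of all idempotent terms of $\mathcal{V}$ into the clone of all idempotent terms of $\mathcal{V}^*$. (2) Hence, $\mathcal{V}^*$ satisfies every idempotent Maltsev condition that holds in $\mathcal{V}$.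
   Context: $\mathcal{F}$ is an algebraic language with no nullary symbols, and $\mathbf{I}=([m];\mathcal{F})$ is a finite $\mathcal{F}$-algebra in the variety $\mathcal{V}$. $(\mathcal{V}\downdownarrows\mathbf{I})$ is the category whose objects are pairs $(\mathbf{A},\chi)$ with $\mathbf{A}\in\mathcal{V}$ and $\chi\colon\mathbf{A}\to\mathbf{I}$ a surjective homomorphism, and whose morphisms $(\mathbf{A},\chi)\to(\mathbf{B},\xi)$ are homomorphisms $\psi$ with $\chi=\xi\circ\psi$. The language $\hat{\mathcal{F}}_{\mathbf{I}}$ consists of an $m$-ary symbol $d$ and, for each $f\in\mathcal{F}$ (say $k$-ary) and each $\mathbf{i}=(i_1,\dots,i_k)\in[m]^k$, a $k$-ary symbol $\hat{f}_{\mathbf{i}}$. For an object $(\mathbf{A},\chi)$ with $D^{(i)}:=\chi^{ -1}(i)$, the algebra $\mathfrak{C}(\mathbf{A},\chi)$ has universe $D^{(1)}\times\dots\times D^{(m)}$ (elements viewed as column vectors), $d$ is the diagonal operation (sending an $m\times m$ matrix of columns to its diagonal), and $\hat{f}_{\mathbf{i}}$ applied to an $m\times k$ matrix $\mathbf{a}=(a_j^{(i)})$ (columns $\mathbf{a}_j$ in $\prod_i D^{(i)}$) returns the first column $\mathbf{a}_1$ with its $f(\mathbf{i})$-th entry ($f(\mathbf{i})$ computed in $\mathbf{I}$) replaced by $f(a_1^{(i_1)},\dots,a_k^{(i_k)})$. The class $\mathcal{V}^*$ is a variety. For a $k$-ary $\hat{\mathcal{F}}_{\mathbf{I}}$-term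 $T$, its coordinate terms are $mk$-ary $\mathcal{F}$-terms $t^{(1)},\dots,t^{(m)}$ such that in every $\mathfrak{C}(\mathbf{A},\chi)$ one has $T(\mathbf{a})=(t^{(1)}(\mathbf{a}),\dots,t^{(m)}(\mathbf{a}))^{T}$ for every $m\times k$ matrix $\mathbf{a}$ with columns in $\prod_i D^{(i)}$ ($T$ applied to the columns, $t^{(i)}$ to the $mk$ entries); any $mk$-ary $\mathcal{F}$-terms $t^{(i)}$ with $t^{(i)}$ evaluating to $i$ in $\mathbf{I}$ on the matrix whose $i$-th row is constant $i$ are the coordinate terms of some such $T$. -}

module Defs where

open import Level using (Lift)
open import Data.Nat using (ℕ; zero; suc; _<_)
open import Data.Fin using (Fin; zero; suc)
open import Data.Vec using (Vec; []; _∷_; map; lookup; tabulate; allFin; _[_]≔_; replicate)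
open import Data.Vec.Properties
  using (lookup-map; tabulate-cong; tabulate-∘; tabulate∘lookup; lookup-allFin; map-[]≔; []≔-lookup)
open import Data.Product using (Σ; _×_; _,_; proj₁; proj₂)
open import Data.List using (List)
open import Data.List.Membership.Propositional using (_∈_)
open import Relation.Binary.PropositionalEquality
open import Function using (_∘_; id)

record Signature : Set₁ where
  field
    Op    : Set
    arity : Op → ℕ
open Signature public

data Term (S : Signature) (X : Set) : Set where
  var : X → Term S X
  app : (f : Op S) → Vec (Term S X) (arity S f) → Term S X

mutual
  _⟨_⟩ : ∀ {S X Y} → Term S X → (X → Term S Y) → Term S Y
  var x    ⟨ σ ⟩ = σ x
  app f ts ⟨ σ ⟩ = app f (substVec ts σ)

  substVec : ∀ {S X Y n} → Vec (Term S X) n → (X → Term S Y) → Vec (Term S Y) n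
  substVec []       σ = []
  substVec (t ∷ ts) σ = (t ⟨ σ ⟩) ∷ substVec ts σ

rename : ∀ {S X Y} → (X → Y) → Term S X → Term S Y
rename ρ t = t ⟨ var ∘ ρ ⟩

record Algebra (S : Signature) : Set₁ where
  field
    Carrier : Set
    op      : (f : Op S) → Vec Carrier (arity S f) → Carrier
open Algebra public

mutual
  eval : ∀ {S X} (A : Algebra S) → Term S X → (X → Carrier A) → Carrier A
  eval A (var x)    ρ = ρ x
  eval A (app f ts) ρ = op A f (evalVec A ts ρ)

  evalVec : ∀ {S X n} (A : Algebra S) → Vec (Term S X) n → (X → Carrier A) → Vec (Carrier A) n
  evalVec A []       ρ = []
  evalVec A (t ∷ ts) ρ = eval A t ρ ∷ evalVec A ts ρ

IsHom : ∀ {S} (A B : Algebra S) → (Carrier A → Carrier B) → Set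
IsHom {S} A B h = ∀ (f : Op S) (as : Vec (Carrier A) (arity S f)) → h (op A f as) ≡ op B f (map h as)

record _≅_ {S : Signature} (A B : Algebra S) : Set where
  field
    to      : Carrier A → Carrier B
    from    : Carrier B → Carrier A
    to-from : ∀ b → to (from b) ≡ b
    from-to : ∀ a → from (to a) ≡ a
    to-hom  : IsHom A B to

Class : Signature → Set₂
Class S = Algebra S → Set₁

_⊨_≈_ : ∀ {S X} → Class S → Term S X → Term S X → Set₁
K ⊨ l ≈ r = ∀ A → K A → ∀ ρ → eval A l ρ ≡ eval A r ρ

Equations : Signature → Set₁
Equations S = (n : ℕ) → Term S (Fin n) → Term S (Fin n) → Set

Mod : ∀ {S} → Equations S → Class S
Mod E A = Lift _ (∀ n l r → E n l r → ∀ ρ → eval A l ρ ≡ eval A r ρ)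

IsIdempotent : ∀ {S k} → Class S → Term S (Fin k) → Set₁
IsIdempotent K t = K ⊨ (t ⟨ (λ _ → var zero) ⟩) ≈ var {X = Fin 1} zero

FinAlg : (F : Signature) (m : ℕ) → ((f : Op F) → Vec (Fin m) (arity F f) → Fin m) → Algebra F
FinAlg F m iop = record { Carrier = Fin m ; op = iop }

module _ (F : Signature) (E : Equations F) (m : ℕ)
         (iop : (f : Op F) → Vec (Fin m) (arity F f) → Fin m) where

  record Object : Set₁ where
    field
      A     : Algebra F
      A∈V   : Mod E A
      χ     : Carrier A → Fin m
      χ-hom : IsHom A (FinAlg F m iop) χ
      χ-surj : ∀ (i : Fin m) → Σ (Carrier A) (λ a → χ a ≡ i)

data OpHat (F : Signature) (m : ℕ) : Set where
  d   : OpHat F m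
  hat : (f : Op F) → Vec (Fin m) (arity F f) → OpHat F m

arityHat : ∀ {F m} → OpHat F m → ℕ
arityHat {m = m} d = m
arityHat {F} (hat f _) = arity F f

Hat : Signature → ℕ → Signature
Hat F m = record { Op = OpHat F m ; arity = arityHat }

first : ∀ {n} → 0 < n → Fin n
first {suc n} _ = zero

module Construction (F : Signature) (nonNullary : ∀ f → 0 < arity F f)
                    (E : Equations F) (m : ℕ)
                    (iop : (f : Op F) → Vec (Fin m) (arity F f) → Fin m)
                    (o : Object F E m iop) where
  open Object o
  I = FinAlg F m iop

  -- D⁽¹⁾ × ⋯ × D⁽ᵐ⁾, D⁽ⁱ⁾ = χ⁻¹(i): column vectors whose i-th entry lies in χ⁻¹(i)
  Col : Set
  Col = Σ (Vec (Carrier A) m) (λ v → map χ v ≡ allFin m)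

  coord : (v : Col) (i : Fin m) → χ (lookup (proj₁ v) i) ≡ i
  coord (v , p) i = trans (sym (lookup-map i χ v)) (trans (cong (λ w → lookup w i) p) (lookup-allFin i))

  dOp : Vec Col m → Col
  dOp cs = tabulate g , trans (sym (tabulate-∘ χ g)) (tabulate-cong (λ i → coord (lookup cs i) i))
    where g = λ i → lookup (proj₁ (lookup cs i)) i

  hatOp : (f : Op F) (is : Vec (Fin m) (arity F f)) → Vec Col (arity F f) → Col
  hatOp f is cs = (base [ pos ]≔ x) , proof
    where
      base = proj₁ (lookup cs (first (nonNullary f)))
      pos  = iop f is
      g    = λ j → lookup (proj₁ (lookup cs j)) (lookup is j)
      x    = op A f (tabulate g)
      χx : χ x ≡ pos
      χx = trans (χ-hom f (tabulate g))
             (cong (iop f) (trans (sym (tabulate-∘ χ g))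
               (trans (tabulate-cong (λ j → coord (lookup cs j) (lookup is j))) (tabulate∘lookup is))))
      proof : map χ (base [ pos ]≔ x) ≡ allFin m
      proof = trans (map-[]≔ χ base pos)
                (trans (cong₂ (λ w y → w [ pos ]≔ y) (proj₂ (lookup cs (first (nonNullary f)))) χx)
                  (trans (cong (λ y → allFin m [ pos ]≔ y) (sym (lookup-allFin pos))) ([]≔-lookup (allFin m) pos)))

  opC : (g : OpHat F m) → Vec Col (arityHat g) → Col
  opC d         = dOp
  opC (hat f is) = hatOp f is

  ℭ : Algebra (Hat F m)
  ℭ = record { Carrier = Col ; op = opC }

ℭ : (F : Signature) (nonNullary : ∀ f → 0 < arity F f) (E : Equations F) (m : ℕ)
    (iop : (f : Op F) → Vec (Fin m) (arity F f) → Fin m) → Object F E m iop → Algebra (Hat F m)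
ℭ F nn E m iop o = Construction.ℭ F nn E m iop o

VStar : (F : Signature) (nonNullary : ∀ f → 0 < arity F f) (E : Equations F) (m : ℕ)
        (iop : (f : Op F) → Vec (Fin m) (arity F f) → Fin m) → Class (Hat F m)
VStar F nn E m iop B = Σ (Object F E m iop) (λ o → B ≅ ℭ F nn E m iop o)

-- ts are coordinate terms of the k-ary F̂_I-term T: in every ℭ(A , χ),
-- the i-th entry of T(𝐚) is tᵢ applied to the m·k entries a_j^(r) (variable (r , j))
IsCoordinateTerms : (F : Signature) (nonNullary : ∀ f → 0 < arity F f) (E : Equations F) (m : ℕ)
                    (iop : (f : Op F) → Vec (Fin m) (arity F f) → Fin m) {k : ℕ} →
                    Term (Hat F m) (Fin k) → (Fin m → Term F (Fin m × Fin k)) → Set₁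
IsCoordinateTerms F nn E m iop {k} T ts =
  ∀ (o : Object F E m iop) (a : Fin k → Construction.Col F nn E m iop o) (i : Fin m) →
    lookup (proj₁ (eval (ℭ F nn E m iop o) T a)) i
      ≡ eval (Object.A o) (ts i) (λ { (r , j) → lookup (proj₁ (a j)) r })

-- φ maps (representatives of) idempotent terms of K to idempotent terms of L
-- and induces a clone homomorphism: well defined on K-equivalence classes,
-- preserves projections and composition (up to L-equivalence).
record IsIdempotentCloneHom {S T : Signature} (K : Class S) (L : Class T)
         (φ : (k : ℕ) → Term S (Fin k) → Term T (Fin k)) : Set₁ where
  field
    idem      : ∀ k (t : Term S (Fin k)) → IsIdempotent K t → IsIdempotent L (φ k t)
    well-def  : ∀ k (t s : Term S (Fin k)) → IsIdempotent K t → IsIdempotent K s →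
                K ⊨ t ≈ s → L ⊨ φ k t ≈ φ k s
    proj      : ∀ k (j : Fin k) → L ⊨ φ k (var j) ≈ var j
    comp      : ∀ k n (t : Term S (Fin k)) (ss : Fin k → Term S (Fin n)) →
                IsIdempotent K t → (∀ j → IsIdempotent K (ss j)) →
                L ⊨ φ n (t ⟨ ss ⟩) ≈ (φ k t ⟨ (λ j → φ n (ss j)) ⟩)

FinSig : (n : ℕ) → (Fin n → ℕ) → Signature
FinSig n ar = record { Op = Fin n ; arity = ar }

record StrongMaltsevCondition : Set where
  field
    nsym       : ℕ
    ar         : Fin nsym → ℕ
    identities : List (Σ ℕ (λ n → Term (FinSig nsym ar) (Fin n) × Term (FinSig nsym ar) (Fin n)))
open StrongMaltsevCondition public

IsIdempotentCondition : StrongMaltsevCondition → Set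
IsIdempotentCondition U =
  ∀ g → (1 , app g (replicate (ar U g) (var zero)) , var zero) ∈ identities U

mutual
  translate : ∀ {S X} (U : StrongMaltsevCondition) → ((g : Fin (nsym U)) → Term S (Fin (ar U g))) →
              Term (FinSig (nsym U) (ar U)) X → Term S X
  translate U ι (var x)    = var x
  translate U ι (app g ts) = ι g ⟨ (λ j → lookup (translateVec U ι ts) j) ⟩

  translateVec : ∀ {S X n} (U : StrongMaltsevCondition) → ((g : Fin (nsym U)) → Term S (Fin (ar U g))) →
                 Vec (Term (FinSig (nsym U) (ar U)) X) n → Vec (Term S X) n
  translateVec U ι []       = []
  translateVec U ι (t ∷ ts) = translate U ι t ∷ translateVec U ι ts

SatisfiesStrong : ∀ {S} → Class S → StrongMaltsevCondition → Set₁
SatisfiesStrong {S} K U =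
  Σ ((g : Fin (nsym U)) → Term S (Fin (ar U g))) λ ι →
    ∀ e → e ∈ identities U → K ⊨ translate U ι (proj₁ (proj₂ e)) ≈ translate U ι (proj₂ (proj₂ e))

record MaltsevCondition : Set₂ where
  field
    cond   : ℕ → StrongMaltsevCondition
    weaker : ∀ n (S : Signature) (E : Equations S) →
             SatisfiesStrong (Mod E) (cond n) → SatisfiesStrong (Mod E) (cond (suc n))
open MaltsevCondition public

IsIdempotentMaltsev : MaltsevCondition → Set
IsIdempotentMaltsev M = ∀ n → IsIdempotentCondition (cond M n)

Satisfies : ∀ {S} → Class S → MaltsevCondition → Set₁
Satisfies K M = Σ ℕ (λ n → SatisfiesStrong K (cond M n))

-- Every ℭ(A, χ) computes an F̂_I-term coordinatewise: if t⁽¹⁾, …, t⁽ᵐ⁾ are coordinate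
-- terms of T, then the i-th entry of T(𝐚) is t⁽ⁱ⁾ evaluated in A ∈ V.  Hence an identity
-- of V between coordinate terms becomes an identity of every ℭ(A, χ), and so of V*, which
-- consists of isomorphic copies of these algebras.  Projections, substitution and the
-- translation of Maltsev-condition terms all act coordinatewise, which gives the clone
-- homomorphism and the transfer of idempotent Maltsev conditions.  A term t̆ exists because
-- any F-term s over the m·k entries can be realised as an F̂_I-term computing s in the
-- coordinate s(I) given by evaluating s in I; for s = t(x₁⁽ⁱ⁾, …, x_k⁽ⁱ⁾) that coordinate is i,
-- as t is idempotent and I ∈ V, and the diagonal operation d collects the m realisations.
module Submission where

open import Defs

open import Data.Nat using (ℕ; _<_)
open import Data.Fin using (Fin; zero; suc)
open import Data.Fin.Properties using (_≟_)
open import Data.Vec using (Vec; []; _∷_; map; lookup; tabulate; replicate)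
open import Data.Vec.Properties using (lookup∘update; lookup∘tabulate; tabulate∘lookup; tabulate-cong; ≡-dec)
open import Data.Product using (Σ; _×_; _,_; proj₁; proj₂)
open import Data.Product.Properties using (Σ-≡,≡→≡)
open import Axiom.UniquenessOfIdentityProofs using (module Decidable⇒UIP)
open import Relation.Binary.PropositionalEquality
open import Function using (_∘_)
open ≡-Reasoning

mutual
  ⟨⟩-cong : ∀ {S X Y} (t : Term S X) {σ τ : X → Term S Y} → (∀ x → σ x ≡ τ x) → t ⟨ σ ⟩ ≡ t ⟨ τ ⟩
  ⟨⟩-cong (var x)    σ≗τ = σ≗τ x
  ⟨⟩-cong (app f ts) σ≗τ = cong (app f) (substVec-cong ts σ≗τ)

  substVec-cong : ∀ {S X Y n} (ts : Vec (Term S X) n) {σ τ : X → Term S Y} →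
                  (∀ x → σ x ≡ τ x) → substVec ts σ ≡ substVec ts τ
  substVec-cong []       σ≗τ = refl
  substVec-cong (t ∷ ts) σ≗τ = cong₂ _∷_ (⟨⟩-cong t σ≗τ) (substVec-cong ts σ≗τ)

module _ {S : Signature} (A : Algebra S) where

  mutual
    eval-⟨⟩ : ∀ {X Y} (t : Term S X) (σ : X → Term S Y) (ρ : Y → Carrier A) →
              eval A (t ⟨ σ ⟩) ρ ≡ eval A t (λ x → eval A (σ x) ρ)
    eval-⟨⟩ (var x)    σ ρ = refl
    eval-⟨⟩ (app f ts) σ ρ = cong (op A f) (evalVec-substVec ts σ ρ)

    evalVec-substVec : ∀ {X Y n} (ts : Vec (Term S X) n) (σ : X → Term S Y) (ρ : Y → Carrier A) →
                       evalVec A (substVec ts σ) ρ ≡ evalVec A ts (λ x → eval A (σ x) ρ)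
    evalVec-substVec []       σ ρ = refl
    evalVec-substVec (t ∷ ts) σ ρ = cong₂ _∷_ (eval-⟨⟩ t σ ρ) (evalVec-substVec ts σ ρ)

  mutual
    eval-cong : ∀ {X} (t : Term S X) {ρ ρ′ : X → Carrier A} → (∀ x → ρ x ≡ ρ′ x) → eval A t ρ ≡ eval A t ρ′
    eval-cong (var x)    ρ≗ρ′ = ρ≗ρ′ x
    eval-cong (app f ts) ρ≗ρ′ = cong (op A f) (evalVec-cong ts ρ≗ρ′)

    evalVec-cong : ∀ {X n} (ts : Vec (Term S X) n) {ρ ρ′ : X → Carrier A} →
                   (∀ x → ρ x ≡ ρ′ x) → evalVec A ts ρ ≡ evalVec A ts ρ′
    evalVec-cong []       ρ≗ρ′ = refl
    evalVec-cong (t ∷ ts) ρ≗ρ′ = cong₂ _∷_ (eval-cong t ρ≗ρ′) (evalVec-cong ts ρ≗ρ′)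

  lookup-evalVec : ∀ {X n} (ts : Vec (Term S X) n) (ρ : X → Carrier A) (i : Fin n) →
                   lookup (evalVec A ts ρ) i ≡ eval A (lookup ts i) ρ
  lookup-evalVec (t ∷ ts) ρ zero    = refl
  lookup-evalVec (t ∷ ts) ρ (suc i) = lookup-evalVec ts ρ i

module _ {S : Signature} {A B : Algebra S} {h : Carrier A → Carrier B} (h-hom : IsHom A B h) where

  mutual
    eval-hom : ∀ {X} (t : Term S X) (ρ : X → Carrier A) → h (eval A t ρ) ≡ eval B t (h ∘ ρ)
    eval-hom (var x)    ρ = refl
    eval-hom (app f ts) ρ = trans (h-hom f (evalVec A ts ρ)) (cong (op B f) (evalVec-hom ts ρ))

    evalVec-hom : ∀ {X n} (ts : Vec (Term S X) n) (ρ : X → Carrier A) →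
                  map h (evalVec A ts ρ) ≡ evalVec B ts (h ∘ ρ)
    evalVec-hom []       ρ = refl
    evalVec-hom (t ∷ ts) ρ = cong₂ _∷_ (eval-hom t ρ) (evalVec-hom ts ρ)

≅-reflects-identity : ∀ {S X} {A B : Algebra S} → A ≅ B → (l r : Term S X) →
                      (∀ ρ → eval B l ρ ≡ eval B r ρ) → ∀ ρ → eval A l ρ ≡ eval A r ρ
≅-reflects-identity {A = A} {B} A≅B l r B⊨l≈r ρ = begin
  eval A l ρ                ≡⟨ sym (from-to _) ⟩
  from (to (eval A l ρ))    ≡⟨ cong from (eval-hom to-hom l ρ) ⟩
  from (eval B l (to ∘ ρ))  ≡⟨ cong from (B⊨l≈r (to ∘ ρ)) ⟩
  from (eval B r (to ∘ ρ))  ≡⟨ cong from (sym (eval-hom to-hom r ρ)) ⟩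
  from (to (eval A r ρ))    ≡⟨ from-to _ ⟩
  eval A r ρ                ∎
  where open _≅_ A≅B

module _ {S : Signature} {K : Class S} where

  IsIdempotent⇒eval-const : ∀ {k} (t : Term S (Fin k)) → IsIdempotent K t →
                            ∀ A → K A → ∀ a → eval A t (λ _ → a) ≡ a
  IsIdempotent⇒eval-const t t-idem A A∈K a =
    trans (sym (eval-⟨⟩ A t (λ _ → var zero) (λ _ → a))) (t-idem A A∈K (λ _ → a))

  eval-const⇒IsIdempotent : ∀ {k} (t : Term S (Fin k)) →
                            (∀ A → K A → ∀ a → eval A t (λ _ → a) ≡ a) → IsIdempotent K t
  eval-const⇒IsIdempotent t t-const A A∈K ρ = trans (eval-⟨⟩ A t (λ _ → var zero) ρ) (t-const A A∈K (ρ zero))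

  IsIdempotent-⟨⟩ : ∀ {k n} (t : Term S (Fin k)) (ss : Fin k → Term S (Fin n)) →
                    IsIdempotent K t → (∀ j → IsIdempotent K (ss j)) → IsIdempotent K (t ⟨ ss ⟩)
  IsIdempotent-⟨⟩ t ss t-idem ss-idem = eval-const⇒IsIdempotent (t ⟨ ss ⟩) λ A A∈K a → begin
    eval A (t ⟨ ss ⟩) (λ _ → a)                   ≡⟨ eval-⟨⟩ A t ss (λ _ → a) ⟩
    eval A t (λ j → eval A (ss j) (λ _ → a))      ≡⟨ eval-cong A t (λ j → IsIdempotent⇒eval-const (ss j) (ss-idem j) A A∈K a) ⟩
    eval A t (λ _ → a)                            ≡⟨ IsIdempotent⇒eval-const t t-idem A A∈K a ⟩
    a                                             ∎

lookup-translateVec-replicate : ∀ {S X} (U : StrongMaltsevCondition) (ι : (g : Fin (nsym U)) → Term S (Fin (ar U g)))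
                                {k} (x : X) (j : Fin k) →
                                lookup (translateVec U ι (replicate k (var x))) j ≡ var x
lookup-translateVec-replicate U ι x zero    = refl
lookup-translateVec-replicate U ι x (suc j) = lookup-translateVec-replicate U ι x j

SatisfiesStrong⇒IsIdempotent : ∀ {S} {K : Class S} {U : StrongMaltsevCondition} → IsIdempotentCondition U →
                               (K⊨U : SatisfiesStrong K U) → ∀ g → IsIdempotent K (proj₁ K⊨U g)
SatisfiesStrong⇒IsIdempotent {K = K} {U} U-idem (ι , K⊨ι) g =
  subst (λ l → K ⊨ l ≈ var zero)
        (⟨⟩-cong (ι g) (lookup-translateVec-replicate U ι zero))
        (K⊨ι _ (U-idem g))

module CoordinateTerms (F : Signature) (nonNullary : ∀ f → 0 < arity F f) (E : Equations F) (m : ℕ)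
                       (iop : (f : Op F) → Vec (Fin m) (arity F f) → Fin m) where

  I : Algebra F
  I = FinAlg F m iop

  V : Class F
  V = Mod E

  V* : Class (Hat F m)
  V* = VStar F nonNullary E m iop

  open Object

  C : Object F E m iop → Algebra (Hat F m)
  C = ℭ F nonNullary E m iop

  Col : Object F E m iop → Set
  Col = Construction.Col F nonNullary E m iop

  entry : ∀ {X : Set} {P : Vec X m → Set} → Σ (Vec X m) P → Fin m → X
  entry c i = lookup (proj₁ c) i

  Col-≡ : ∀ {o} {c c′ : Col o} → (∀ i → entry c i ≡ entry c′ i) → c ≡ c′
  Col-≡ {c = v , _} {v′ , p′} v≗v′ = Σ-≡,≡→≡ (v≡v′ , Decidable⇒UIP.≡-irrelevant (≡-dec _≟_) _ p′)
    where
      v≡v′ : v ≡ v′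
      v≡v′ = trans (sym (tabulate∘lookup v)) (trans (tabulate-cong v≗v′) (tabulate∘lookup v′))

  record Coordinatewise {X} (T : Term (Hat F m) X) (t : Term F X) : Set₁ where
    constructor coordinatewise
    field
      entry-eval : ∀ o (a : X → Col o) i → entry (eval (C o) T a) i ≡ eval (A o) t (λ x → entry (a x) i)
  open Coordinatewise

  IsCoordinateTerms⇒Coordinatewise : ∀ {k} (T : Term (Hat F m) (Fin k)) (t : Term F (Fin k)) →
    IsCoordinateTerms F nonNullary E m iop T (λ i → rename (i ,_) t) → Coordinatewise T t
  IsCoordinateTerms⇒Coordinatewise T t T-coords = coordinatewise λ o a i →
    trans (T-coords o a i) (eval-⟨⟩ (A o) t (λ j → var (i , j)) _)

  Coordinatewise-var : ∀ {X} (x : X) → Coordinatewise (var x) (var x)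
  Coordinatewise-var x = coordinatewise λ o a i → refl

  Coordinatewise-⟨⟩ : ∀ {X Y} {T : Term (Hat F m) X} {t : Term F X} {τ : X → Term (Hat F m) Y} {σ : X → Term F Y} →
                      Coordinatewise T t → (∀ x → Coordinatewise (τ x) (σ x)) → Coordinatewise (T ⟨ τ ⟩) (t ⟨ σ ⟩)
  Coordinatewise-⟨⟩ {T = T} {t} {τ} {σ} T∼t τ∼σ = coordinatewise λ o a i → begin
    entry (eval (C o) (T ⟨ τ ⟩) a) i                             ≡⟨ cong (λ c → entry c i) (eval-⟨⟩ (C o) T τ a) ⟩
    entry (eval (C o) T (λ x → eval (C o) (τ x) a)) i            ≡⟨ entry-eval T∼t o _ i ⟩
    eval (A o) t (λ x → entry (eval (C o) (τ x) a) i)            ≡⟨ eval-cong (A o) t (λ x → entry-eval (τ∼σ x) o a i) ⟩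
    eval (A o) t (λ x → eval (A o) (σ x) (λ y → entry (a y) i))  ≡⟨ sym (eval-⟨⟩ (A o) t σ _) ⟩
    eval (A o) (t ⟨ σ ⟩) (λ y → entry (a y) i)                   ∎

  module _ (U : StrongMaltsevCondition)
           {ι* : (g : Fin (nsym U)) → Term (Hat F m) (Fin (ar U g))} {ι : (g : Fin (nsym U)) → Term F (Fin (ar U g))}
           (ι*∼ι : ∀ g → Coordinatewise (ι* g) (ι g)) where

    mutual
      Coordinatewise-translate : ∀ {X} (u : Term (FinSig (nsym U) (ar U)) X) →
                                 Coordinatewise (translate U ι* u) (translate U ι u)
      Coordinatewise-translate (var x)    = Coordinatewise-var x
      Coordinatewise-translate (app g us) = Coordinatewise-⟨⟩ (ι*∼ι g) (Coordinatewise-translateVec us)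

      Coordinatewise-translateVec : ∀ {X n} (us : Vec (Term (FinSig (nsym U) (ar U)) X) n) (j : Fin n) →
        Coordinatewise (lookup (translateVec U ι* us) j) (lookup (translateVec U ι us) j)
      Coordinatewise-translateVec (u ∷ us) zero    = Coordinatewise-translate u
      Coordinatewise-translateVec (u ∷ us) (suc j) = Coordinatewise-translateVec us j

  Coordinatewise-⊨ : ∀ {X} {T T′ : Term (Hat F m) X} {t t′ : Term F X} →
                     Coordinatewise T t → Coordinatewise T′ t′ → V ⊨ t ≈ t′ → V* ⊨ T ≈ T′
  Coordinatewise-⊨ {T = T} {T′} T∼t T′∼t′ V⊨t≈t′ B (o , B≅ℭ) =
    ≅-reflects-identity B≅ℭ T T′ λ a → Col-≡ {o} λ i →
      trans (entry-eval T∼t o a i) (trans (V⊨t≈t′ (A o) (A∈V o) _) (sym (entry-eval T′∼t′ o a i)))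

  Coordinatewise-IsIdempotent : ∀ {k} {T : Term (Hat F m) (Fin k)} {t : Term F (Fin k)} →
                                Coordinatewise T t → IsIdempotent V t → IsIdempotent V* T
  Coordinatewise-IsIdempotent T∼t =
    Coordinatewise-⊨ (Coordinatewise-⟨⟩ T∼t (λ _ → Coordinatewise-var zero)) (Coordinatewise-var zero)

  -- Choosing 𝐢 as the I-values of the arguments makes f̂_𝐢 write its result into the
  -- coordinate f(𝐢), which is the I-value of the whole term.
  mutual
    realise : ∀ {k} → Term F (Fin m × Fin k) → Term (Hat F m) (Fin k)
    realise (var (r , j)) = var j
    realise (app f ss)    = app (hat f (evalVec I ss proj₁)) (realiseVec ss)

    realiseVec : ∀ {k n} → Vec (Term F (Fin m × Fin k)) n → Vec (Term (Hat F m) (Fin k)) n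
    realiseVec []       = []
    realiseVec (s ∷ ss) = realise s ∷ realiseVec ss

  module _ (o : Object F E m iop) where

    entries : ∀ {k} → (Fin k → Col o) → Fin m × Fin k → Carrier (A o)
    entries a (r , j) = entry (a j) r

    mutual
      entry-realise : ∀ {k} (s : Term F (Fin m × Fin k)) (a : Fin k → Col o) →
                      entry (eval (C o) (realise s) a) (eval I s proj₁) ≡ eval (A o) s (entries a)
      entry-realise (var (r , j)) a = refl
      entry-realise (app f ss)    a =
        trans (lookup∘update (iop f (evalVec I ss proj₁)) (proj₁ (lookup (evalVec (C o) (realiseVec ss) a) (first (nonNullary f)))) _)
              (cong (op (A o) f) (entries-realiseVec ss a))

      entries-realiseVec : ∀ {k n} (ss : Vec (Term F (Fin m × Fin k)) n) (a : Fin k → Col o) →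
        tabulate (λ l → entry (lookup (evalVec (C o) (realiseVec ss) a) l) (lookup (evalVec I ss proj₁) l))
          ≡ evalVec (A o) ss (entries a)
      entries-realiseVec []       a = refl
      entries-realiseVec (s ∷ ss) a = cong₂ _∷_ (entry-realise s a) (entries-realiseVec ss a)

  breve : (k : ℕ) → Term F (Fin k) → Term (Hat F m) (Fin k)
  breve k t = app d (tabulate λ i → realise (rename (i ,_) t))

  breve-IsCoordinateTerms : Mod E I → ∀ {k} (t : Term F (Fin k)) → IsIdempotent V t →
                            IsCoordinateTerms F nonNullary E m iop (breve k t) (λ i → rename (i ,_) t)
  breve-IsCoordinateTerms I∈V {k} t t-idem o a i = begin
    lookup (tabulate λ i′ → entry (lookup (evalVec (C o) Ts a) i′) i′) i  ≡⟨ lookup∘tabulate _ i ⟩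
    entry (lookup (evalVec (C o) Ts a) i) i                            ≡⟨ cong (λ c → entry c i) (lookup-evalVec (C o) Ts a i) ⟩
    entry (eval (C o) (lookup Ts i) a) i                               ≡⟨ cong (λ T → entry (eval (C o) T a) i) (lookup∘tabulate _ i) ⟩
    entry (eval (C o) (realise tᵢ) a) i                                ≡⟨ cong (entry (eval (C o) (realise tᵢ) a)) (sym tᵢ-in-I) ⟩
    entry (eval (C o) (realise tᵢ) a) (eval I tᵢ proj₁)                ≡⟨ entry-realise o tᵢ a ⟩
    eval (A o) tᵢ (entries o a)                                        ≡⟨ eval-cong (A o) tᵢ (λ { (r , j) → refl }) ⟩
    eval (A o) tᵢ (λ { (r , j) → entry (a j) r })                      ∎
    where
      Ts : Vec (Term (Hat F m) (Fin k)) m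
      Ts = tabulate λ i′ → realise (rename (i′ ,_) t)
      tᵢ : Term F (Fin m × Fin k)
      tᵢ = rename (i ,_) t
      tᵢ-in-I : eval I tᵢ proj₁ ≡ i
      tᵢ-in-I = trans (eval-⟨⟩ I t (λ j → var (i , j)) proj₁) (IsIdempotent⇒eval-const t t-idem I I∈V i)

  breve-spec : Mod E I → ∀ k (t : Term F (Fin k)) → IsIdempotent V t →
               IsIdempotent V* (breve k t) × IsCoordinateTerms F nonNullary E m iop (breve k t) (λ i → rename (i ,_) t)
  breve-spec I∈V k t t-idem =
    Coordinatewise-IsIdempotent (IsCoordinateTerms⇒Coordinatewise (breve k t) t t-coords) t-idem , t-coords
    where
      t-coords : IsCoordinateTerms F nonNullary E m iop (breve k t) (λ i → rename (i ,_) t)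
      t-coords = breve-IsCoordinateTerms I∈V t t-idem

  module _ (φ : (k : ℕ) → Term F (Fin k) → Term (Hat F m) (Fin k))
           (φ-spec : ∀ k (t : Term F (Fin k)) → IsIdempotent V t →
              IsIdempotent V* (φ k t) × IsCoordinateTerms F nonNullary E m iop (φ k t) (λ i → rename (i ,_) t)) where

    φ-coordinatewise : ∀ {k} (t : Term F (Fin k)) → IsIdempotent V t → Coordinatewise (φ k t) t
    φ-coordinatewise t t-idem = IsCoordinateTerms⇒Coordinatewise (φ _ t) t (proj₂ (φ-spec _ t t-idem))

    coordinate-terms⇒IsIdempotentCloneHom : IsIdempotentCloneHom V V* φ
    coordinate-terms⇒IsIdempotentCloneHom = record
      { idem     = λ k t t-idem → proj₁ (φ-spec k t t-idem)
      ; well-def = λ k t s t-idem s-idem → Coordinatewise-⊨ (φ-coordinatewise t t-idem) (φ-coordinatewise s s-idem)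
      ; proj     = λ k j → Coordinatewise-⊨ (φ-coordinatewise (var j) (λ _ _ _ → refl)) (Coordinatewise-var j) (λ _ _ _ → refl)
      ; comp     = λ k n t ss t-idem ss-idem →
          Coordinatewise-⊨ (φ-coordinatewise (t ⟨ ss ⟩) (IsIdempotent-⟨⟩ t ss t-idem ss-idem))
                           (Coordinatewise-⟨⟩ (φ-coordinatewise t t-idem) (λ j → φ-coordinatewise (ss j) (ss-idem j)))
                           (λ _ _ _ → refl)
      }

  IsIdempotentMaltsev⇒Satisfies-VStar : Mod E I → ∀ (M : MaltsevCondition) → IsIdempotentMaltsev M →
                                         Satisfies V M → Satisfies V* M
  IsIdempotentMaltsev⇒Satisfies-VStar I∈V M M-idem (n , ι , V⊨ι) =
    n , (λ g → breve _ (ι g)) , λ e e∈U →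
      Coordinatewise-⊨ (Coordinatewise-translate U breve-ι∼ι (proj₁ (proj₂ e)))
                       (Coordinatewise-translate U breve-ι∼ι (proj₂ (proj₂ e)))
                       (V⊨ι e e∈U)
    where
      U : StrongMaltsevCondition
      U = cond M n
      breve-ι∼ι : ∀ g → Coordinatewise (breve _ (ι g)) (ι g)
      breve-ι∼ι g = IsCoordinateTerms⇒Coordinatewise _ (ι g)
                      (breve-IsCoordinateTerms I∈V (ι g) (SatisfiesStrong⇒IsIdempotent (M-idem n) (ι , V⊨ι) g))

corollary3p12 :
    (F : Signature) (nonNullary : ∀ f → 0 < arity F f) (E : Equations F)
    (m : ℕ) (m>0 : 0 < m) (iop : (f : Op F) → Vec (Fin m) (arity F f) → Fin m)
    (I∈V : Mod E (FinAlg F m iop)) →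
    -- (1) t ↦ t̆ (t̆ idempotent in V*, with coordinate terms t(x₁⁽ⁱ⁾,…,x_k⁽ⁱ⁾))
    --     exists, and any such assignment is a clone homomorphism
    --     Idem(V) → Idem(V*)
    ( Σ ((k : ℕ) → Term F (Fin k) → Term (Hat F m) (Fin k)) (λ breve →
        ∀ k (t : Term F (Fin k)) → IsIdempotent (Mod E) t →
          IsIdempotent (VStar F nonNullary E m iop) (breve k t)
          × IsCoordinateTerms F nonNullary E m iop (breve k t) (λ i → rename (λ j → (i , j)) t))
    × ( ∀ (breve : (k : ℕ) → Term F (Fin k) → Term (Hat F m) (Fin k)) →
        (∀ k (t : Term F (Fin k)) → IsIdempotent (Mod E) t →
          IsIdempotent (VStar F nonNullary E m iop) (breve k t)
          × IsCoordinateTerms F nonNullary E m iop (breve k t) (λ i → rename (λ j → (i , j)) t)) →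
        IsIdempotentCloneHom (Mod E) (VStar F nonNullary E m iop) breve ) )
    -- (2) every idempotent Maltsev condition holding in V holds in V*
    × ( ∀ (M : MaltsevCondition) → IsIdempotentMaltsev M →
        Satisfies (Mod E) M → Satisfies (VStar F nonNullary E m iop) M )
corollary3p12 F nonNullary E m _ iop I∈V =
  ((breve , breve-spec I∈V) , coordinate-terms⇒IsIdempotentCloneHom) , IsIdempotentMaltsev⇒Satisfies-VStar I∈V
  where open CoordinateTerms F nonNullary E m iop
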